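{- Let $k\ge2$ and $n$ be positive integers. Let $Q_n=\{p_1,\dots,p_t\}$ be the set of primes not exceeding $\sqrt n$ and $R_n$ the set of primes in the interval $(\sqrt n,n]$. Let $A$ be a set each of whose elements is a product $p_ip_j$ of two distinct primes $p_i,p_j\in Q_n$, and let $S=R_n\cup A$. Let $G(A)$ be the graph with vertex set $\{P_1,\dots,P_t\}$ in which $P_i$ and $P_j$ are adjacent if and only if $p_ip_j\in A$. If $G(A)$ contains no cycle of length $\ell$ for any $3\le\ell\le 2k$, then the equation $a_1a_2\cdots a_{3k}=x^3$ with $a_1,\dots,a_{3k}\in S$ (not necessarily distinct) and $x$ an integer has no solutions other than trivial ones.
   Context: A solution of $a_1\cdots a_{3k}=x^3$ is trivial if the multiset $\{a_1,\dots,a_{3k}\}$ can be partitioned into 3-element sub-multisets each consisting of three copies of the same number. -}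

module Defs where

open import Data.Nat using (ℕ; _*_; _≤_; _<_)
open import Data.Nat.Primality using (Prime)
open import Data.List using (List; []; _∷_; _++_; take; length; concatMap)
open import Data.List.Relation.Unary.All using (All)
open import Data.List.Relation.Unary.Unique.Propositional using (Unique)
open import Data.List.Relation.Unary.Linked using (Linked)
open import Data.List.Relation.Binary.Permutation.Propositional using (_↭_)
open import Data.Product using (_×_; Σ; ∃)
open import Data.Sum using (_⊎_)
open import Relation.Binary.PropositionalEquality using (_≡_; _≢_)

Qn : ℕ → ℕ → Set
Qn n p = Prime p × p * p ≤ n

Rn : ℕ → ℕ → Set
Rn n p = Prime p × n < p * p × p ≤ n

IsProductSet : ℕ → (ℕ → Set) → Set
IsProductSet n A = ∀ m → A m → Σ ℕ λ p → Σ ℕ λ q → Qn n p × Qn n q × p ≢ q × m ≡ p * q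

Sset : ℕ → (ℕ → Set) → ℕ → Set
Sset n A m = Rn n m ⊎ A m

Adj : (ℕ → Set) → ℕ → ℕ → Set
Adj A p q = p ≢ q × A (p * q)

-- G(A) contains a cycle of length ℓ: distinct vertices v₀,…,v_{ℓ-1} of G(A)
-- with v_i ~ v_{i+1} and v_{ℓ-1} ~ v₀
HasCycle : ℕ → (ℕ → Set) → ℕ → Set
HasCycle n A ℓ = ∃ λ (vs : List ℕ) →
  length vs ≡ ℓ × Unique vs × All (Qn n) vs × Linked (Adj A) (vs ++ take 1 vs)

triple : ℕ → List ℕ
triple y = y ∷ y ∷ y ∷ []

Trivial : List ℕ → Set
Trivial as = ∃ λ (bs : List ℕ) → as ↭ concatMap triple bs

-- Elements of S are squarefree, so for every prime v the exponent of v in a₁⋯a₃ₖ is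
-- deg v, the number of indices i with v ∣ aᵢ; as the product is a cube, 3 ∣ deg v.
-- The solution is trivial iff every value occurs among the aᵢ a multiple of 3 times;
-- call a value unbalanced otherwise. An unbalanced prime r ∈ Rₙ is impossible, since
-- the only aᵢ divisible by r are copies of r. An unbalanced value p q ∈ A is an edge
-- of G(A), and 3 ∣ deg q forces a second unbalanced edge at q. Walking along
-- unbalanced edges without backtracking must close a cycle, of length at most 2k:
-- each vertex on it divides at least three of the aᵢ, while each aᵢ has at most two
-- prime factors in Qₙ, so double counting gives 3 ℓ ≤ 2 · 3k.
{-# OPTIONS --safe #-}
module Submission where

open import Data.List using (List; []; _∷_; _++_; [_]; _∷ʳ_; length; filter; replicate; concatMap; take)
open import Data.List.Membership.Propositional using (_∈_; find; lose)
open import Data.List.Membership.Propositional.Properties using (∈-filter⁻; ∈-∃++)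
open import Data.List.Properties
  using ( filter-reject; filter-some; filter-notAll; partition-defn; concatMap-++; ++-assoc
        ; length-++; length-replicate; length-++-≤ʳ)
open import Data.List.Relation.Binary.Permutation.Propositional
  using (_↭_; ↭-refl; ↭ₛ⇒↭; module PermutationReasoning)
open import Data.List.Relation.Binary.Permutation.Propositional.Properties using (↭-length; ++⁺ˡ)
import Data.List.Relation.Binary.Permutation.Setoid.Properties as Permutationₛ
open import Data.List.Relation.Unary.All using (All; []; _∷_)
import Data.List.Relation.Unary.All as All
open import Data.List.Relation.Unary.All.Properties using (¬Any⇒All¬; ¬All⇒Any¬; ++⁻ˡ; all-filter)
import Data.List.Relation.Unary.All.Properties as All
open import Data.List.Relation.Unary.AllPairs using (AllPairs; []; _∷_)
open import Data.List.Relation.Unary.Any using (here)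
open import Data.List.Relation.Unary.Linked using (Linked; []; [-]; _∷_)
import Data.List.Relation.Unary.Linked as Linked
open import Data.List.Relation.Unary.Unique.Propositional using (Unique)
import Data.List.Relation.Unary.Unique.Propositional.Properties as Unique
open import Data.Nat
  using (ℕ; zero; suc; _+_; _*_; _^_; _≤_; _<_; z≤n; s≤s; z<s; _≟_; NonZero; >-nonZero; nonTrivial⇒n>1)
open import Data.Nat.Divisibility
  using (_∣_; _∣?_; divides; _∣0; ∣-refl; ∣-trans; ∣1⇒≡1; m∣m*n; n∣m*n; ∣m⇒∣m*n; *-cancelˡ-∣; ∣m+n∣m⇒∣n; ∣⇒≤)
open import Data.Nat.Induction using (<-wellFounded)
open import Data.Nat.ListAction using (product)
open import Data.Nat.Primality
  using (Prime; ¬prime[1]; prime⇒nonZero; prime⇒nonTrivial; prime⇒irreducible; euclidsLemma)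
open import Data.Nat.Properties
  using ( +-comm; +-identityʳ; +-suc; *-comm; *-assoc; *-identityˡ; *-identityʳ; *-zeroʳ; *-suc; ^-*-assoc
        ; *-cancelˡ-≡; m*n≡0⇒m≡0; m*n≢0⇒m≢0; m^n≢0; ≤-refl; ≤-reflexive; ≤-trans; <⇒≱; +-mono-≤
        ; *-cancelˡ-≤; m<n+m; m<m*n; +-commutativeSemigroup; *-commutativeSemigroup; module ≤-Reasoning)
open import Data.Product using (_×_; _,_; proj₁; proj₂; ∃; ∃₂; ∃-syntax)
open import Data.Sum using (_⊎_; inj₁; inj₂; [_,_]′)
import Data.Sum as Sum
open import Function using (_∘_)
open import Induction.WellFounded using (Acc; acc)
open import Level using (Level; _⊔_)
open import Relation.Binary.Core using (Rel)
open import Relation.Binary.Definitions using (DecidableEquality; Symmetric)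
open import Relation.Binary.PropositionalEquality
  using (_≡_; _≢_; refl; sym; trans; cong; cong₂; subst; subst₂; setoid; module ≡-Reasoning)
open import Relation.Nullary using (¬_; Dec; yes; no; contradiction)
open import Relation.Nullary.Decidable using (decidable-stable)
open import Relation.Unary using (Pred; Decidable; _⊆_)
open import Relation.Unary.Properties using (∁?)

open import Algebra.Properties.CommutativeSemigroup +-commutativeSemigroup
  using () renaming (x∙yz≈y∙xz to +-exchange)
open import Algebra.Properties.CommutativeSemigroup *-commutativeSemigroup
  using () renaming (x∙yz≈y∙xz to *-exchange; interchange to *-interchange)

open import Defs

private
  variable
    a ℓ ℓ₁ ℓ₂ : Level
    A : Set a

-- Counting in lists

count : {P : Pred A ℓ} → Decidable P → List A → ℕ
count P? xs = length (filter P? xs)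

module _ {P : Pred A ℓ₁} {Q : Pred A ℓ₂} (P? : Decidable P) (Q? : Decidable Q) where

  filter-filter-⊆ : P ⊆ Q → ∀ xs → filter P? (filter Q? xs) ≡ filter P? xs
  filter-filter-⊆ P⊆Q []       = refl
  filter-filter-⊆ P⊆Q (x ∷ xs) with Q? x
  ... | no ¬Qx = trans (filter-filter-⊆ P⊆Q xs) (sym (filter-reject P? (¬Qx ∘ P⊆Q)))
  ... | yes _ with P? x
  ...   | yes _ = cong (x ∷_) (filter-filter-⊆ P⊆Q xs)
  ...   | no _  = filter-filter-⊆ P⊆Q xs

↭-filter-split : {P : Pred A ℓ} (P? : Decidable P) (xs : List A) →
                 xs ↭ filter P? xs ++ filter (∁? P?) xs
↭-filter-split {A = A} P? xs =
  subst (λ (ys , zs) → xs ↭ ys ++ zs) (partition-defn P? xs)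
        (↭ₛ⇒↭ (Permutationₛ.partition-↭ (setoid A) P? xs))

replicate-+ : ∀ m n (x : A) → replicate (m + n) x ≡ replicate m x ++ replicate n x
replicate-+ zero    n x = refl
replicate-+ (suc m) n x = cong (x ∷_) (replicate-+ m n x)

concatMap-replicate-replicate : ∀ d q (x : A) →
                                concatMap (replicate d) (replicate q x) ≡ replicate (q * d) x
concatMap-replicate-replicate d zero    x = refl
concatMap-replicate-replicate d (suc q) x =
  trans (cong (replicate d x ++_) (concatMap-replicate-replicate d q x))
        (sym (replicate-+ d (q * d) x))

length-concatMap-replicate : ∀ d (bs : List A) → length (concatMap (replicate d) bs) ≡ length bs * d
length-concatMap-replicate d []       = refl
length-concatMap-replicate d (b ∷ bs) =
  trans (length-++ (replicate d b)) (cong₂ _+_ (length-replicate d) (length-concatMap-replicate d bs))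

module Multiplicity {A : Set a} (_≟_ : DecidableEquality A) where

  multiplicity : A → List A → ℕ
  multiplicity w = count (w ≟_)

  multiplicity-filter : {P : Pred A ℓ} (P? : Decidable P) {w : A} → P w → ∀ xs →
                        multiplicity w (filter P? xs) ≡ multiplicity w xs
  multiplicity-filter P? Pw xs = cong length (filter-filter-⊆ (_ ≟_) P? (λ { refl → Pw }) xs)

  filter-≟-replicate : ∀ w xs → filter (w ≟_) xs ≡ replicate (multiplicity w xs) w
  filter-≟-replicate w []       = refl
  filter-≟-replicate w (x ∷ xs) with w ≟ x
  ... | yes refl = cong (w ∷_) (filter-≟-replicate w xs)
  ... | no _     = filter-≟-replicate w xs

  count-split : {P : Pred A ℓ} (P? : Decidable P) {e : A} → P e → ∀ xs →
                count P? xs ≡ multiplicity e xs + count (∁? (e ≟_)) (filter P? xs)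
  count-split P? {e} Pe xs = begin
    length (filter P? xs)
      ≡⟨ ↭-length (↭-filter-split (e ≟_) (filter P? xs)) ⟩
    length (filter (e ≟_) (filter P? xs) ++ others)
      ≡⟨ length-++ (filter (e ≟_) (filter P? xs)) ⟩
    multiplicity e (filter P? xs) + length others
      ≡⟨ cong (_+ length others) (multiplicity-filter P? Pe xs) ⟩
    multiplicity e xs + length others ∎
    where
    open ≡-Reasoning
    others = filter (∁? (e ≟_)) (filter P? xs)

  ↭-concatMap-replicate : ∀ d xs → All (λ w → d ∣ multiplicity w xs) xs →
                          ∃[ bs ] xs ↭ concatMap (replicate d) bs
  ↭-concatMap-replicate d xs = go xs (<-wellFounded (length xs))
    where
    go : ∀ xs → Acc _<_ (length xs) → All (λ w → d ∣ multiplicity w xs) xs →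
         ∃[ bs ] xs ↭ concatMap (replicate d) bs
    go []          _         _                          = [] , ↭-refl
    go xs@(h ∷ _)  (acc rec) d∣xs@(divides q h-mult ∷ _) =
      let bs , rest↭ = go rest (rec shorter) (All.tabulate d∣rest) in
      replicate q h ++ bs , (begin
        xs                                                 ↭⟨ ↭-filter-split (h ≟_) xs ⟩
        filter (h ≟_) xs ++ rest                           ≡⟨ cong (_++ rest) (filter-≟-replicate h xs) ⟩
        replicate (multiplicity h xs) h ++ rest            ≡⟨ cong (λ m → replicate m h ++ rest) h-mult ⟩
        replicate (q * d) h ++ rest                        ↭⟨ ++⁺ˡ (replicate (q * d) h) rest↭ ⟩
        replicate (q * d) h ++ concatMap (replicate d) bs  ≡⟨ cong (_++ concatMap (replicate d) bs)
                                                                   (concatMap-replicate-replicate d q h) ⟨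
        concatMap (replicate d) (replicate q h) ++ concatMap (replicate d) bs
                                                           ≡⟨ concatMap-++ (replicate d) (replicate q h) bs ⟨
        concatMap (replicate d) (replicate q h ++ bs)      ∎)
      where
      open PermutationReasoning
      rest = filter (∁? (h ≟_)) xs
      shorter : length rest < length xs
      shorter = filter-notAll (∁? (h ≟_)) xs (here (λ h≢h → h≢h refl))
      d∣rest : ∀ {w} → w ∈ rest → d ∣ multiplicity w rest
      d∣rest w∈rest with w∈xs , h≢w ← ∈-filter⁻ (∁? (h ≟_)) w∈rest =
        subst (d ∣_) (sym (multiplicity-filter (∁? (h ≟_)) h≢w xs)) (All.lookup d∣xs w∈xs)

  divisible-multiplicities⇒∣length : ∀ d xs → All (λ w → d ∣ multiplicity w xs) xs → d ∣ length xs
  divisible-multiplicities⇒∣length d xs d∣xs =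
    let bs , xs↭ = ↭-concatMap-replicate d xs d∣xs in
    divides (length bs) (trans (↭-length xs↭) (length-concatMap-replicate d bs))

module _ {B : Set} {R : A → B → Set} (R? : ∀ v b → Dec (R v b)) where

  incidences : List A → List B → ℕ
  incidences []      bs = 0
  incidences (v ∷ C) bs = count (R? v) bs + incidences C bs

  incidences-∷ : ∀ C b bs → incidences C (b ∷ bs) ≡ count (λ v → R? v b) C + incidences C bs
  incidences-∷ []      b bs = refl
  incidences-∷ (v ∷ C) b bs with R? v b
  ... | yes _ = cong suc (trans (cong (count (R? v) bs +_) (incidences-∷ C b bs))
                                (+-exchange (count (R? v) bs) (count (λ u → R? u b) C) (incidences C bs)))
  ... | no _  = trans (cong (count (R? v) bs +_) (incidences-∷ C b bs))
                      (+-exchange (count (R? v) bs) (count (λ u → R? u b) C) (incidences C bs))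

  double-counting : ∀ {c d} C bs →
                    All (λ v → d ≤ count (R? v) bs) C → All (λ b → count (λ v → R? v b) C ≤ c) bs →
                    d * length C ≤ c * length bs
  double-counting {c} {d} C bs lower upper = ≤-trans (below C lower) (above bs upper)
    where
    below : ∀ C → All (λ v → d ≤ count (R? v) bs) C → d * length C ≤ incidences C bs
    below []      []            = ≤-reflexive (*-zeroʳ d)
    below (v ∷ C) (d≤v ∷ lower) =
      subst (_≤ incidences (v ∷ C) bs) (sym (*-suc d (length C))) (+-mono-≤ d≤v (below C lower))
    no-incidences : ∀ C → incidences C [] ≡ 0
    no-incidences []      = refl
    no-incidences (v ∷ C) = no-incidences C
    above : ∀ bs → All (λ b → count (λ v → R? v b) C ≤ c) bs → incidences C bs ≤ c * length bs
    above []       []            = ≤-reflexive (trans (no-incidences C) (sym (*-zeroʳ c)))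
    above (b ∷ bs) (b≤c ∷ upper) =
      subst₂ _≤_ (sym (incidences-∷ C b bs)) (sym (*-suc c (length bs))) (+-mono-≤ b≤c (above bs upper))

two-of-three : ∀ {x y z u v : A} → x ≡ u ⊎ x ≡ v → y ≡ u ⊎ y ≡ v → z ≡ u ⊎ z ≡ v →
               x ≡ y ⊎ x ≡ z ⊎ y ≡ z
two-of-three (inj₁ refl) (inj₁ refl) _           = inj₁ refl
two-of-three (inj₁ refl) (inj₂ refl) (inj₁ refl) = inj₂ (inj₁ refl)
two-of-three (inj₁ refl) (inj₂ refl) (inj₂ refl) = inj₂ (inj₂ refl)
two-of-three (inj₂ refl) (inj₂ refl) _           = inj₁ refl
two-of-three (inj₂ refl) (inj₁ refl) (inj₁ refl) = inj₂ (inj₂ refl)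
two-of-three (inj₂ refl) (inj₁ refl) (inj₂ refl) = inj₂ (inj₁ refl)

unique-pair-length≤2 : ∀ {u v : A} {xs} → Unique xs → All (λ x → x ≡ u ⊎ x ≡ v) xs → length xs ≤ 2
unique-pair-length≤2 {xs = []}         _ _ = z≤n
unique-pair-length≤2 {xs = _ ∷ []}     _ _ = s≤s z≤n
unique-pair-length≤2 {xs = _ ∷ _ ∷ []} _ _ = ≤-refl
unique-pair-length≤2 ((x≢y ∷ x≢z ∷ _) ∷ (y≢z ∷ _) ∷ _) (x∈ ∷ y∈ ∷ z∈ ∷ _) =
  contradiction (two-of-three x∈ y∈ z∈) [ x≢y , [ x≢z , y≢z ]′ ]′

-- Cycles in graphs

module _ {R : Rel A ℓ} where

  AllPairs-++⁻ˡ : ∀ xs {ys} → AllPairs R (xs ++ ys) → AllPairs R xs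
  AllPairs-++⁻ˡ []       _          = []
  AllPairs-++⁻ˡ (x ∷ xs) (Rx ∷ Rxs) = ++⁻ˡ xs Rx ∷ AllPairs-++⁻ˡ xs Rxs

  Linked-++⁻ˡ : ∀ xs {ys} → Linked R (xs ++ ys) → Linked R xs
  Linked-++⁻ˡ []           _          = []
  Linked-++⁻ˡ (x ∷ [])     _          = [-]
  Linked-++⁻ˡ (x ∷ y ∷ xs) (Rxy ∷ Rs) = Rxy ∷ Linked-++⁻ˡ (y ∷ xs) Rs

  Linked-∷ʳ⁺ : ∀ xs {x y} → Linked R (xs ∷ʳ x) → R x y → Linked R (xs ∷ʳ x ∷ʳ y)
  Linked-∷ʳ⁺ []           _          Rxy = Rxy ∷ [-]
  Linked-∷ʳ⁺ (x ∷ [])     (Rx ∷ _)   Rxy = Rx ∷ Rxy ∷ [-]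
  Linked-∷ʳ⁺ (x ∷ y ∷ xs) (Rxy ∷ Rs) Rz  = Rxy ∷ Linked-∷ʳ⁺ (y ∷ xs) Rs Rz

module Cycles {V : Set a} (_≟_ : DecidableEquality V) {E : Rel V ℓ}
              (E-sym : Symmetric E) (E-irrefl : ∀ {v} → ¬ E v v)
              (E-extend : ∀ {u v} → E u v → ∃[ w ] (w ≢ u × E v w))
              {N : ℕ} (few-vertices : ∀ {vs} → Unique vs → All (∃ ∘ E) vs → length vs ≤ N)
              where

  open import Data.List.Membership.DecPropositional _≟_ using (_∈?_)

  Cycle : Set (a ⊔ ℓ)
  Cycle = ∃[ vs ] (3 ≤ length vs × Unique vs × All (∃ ∘ E) vs × Linked E (vs ++ take 1 vs))

  -- A path, most recent vertex first; the fuel runs out only once it exceeds N vertices.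
  private
    walk : ∀ fuel {cur prev} rest → let path = cur ∷ prev ∷ rest in
           Unique path → All (∃ ∘ E) path → Linked E path → N < length path + fuel → Cycle
    walk zero _ uniq active _ N<path =
      contradiction (few-vertices uniq active) (<⇒≱ (subst (N <_) (+-identityʳ _) N<path))
    walk (suc fuel) {cur} {prev} rest uniq active linked N<path
      with w , w≢prev , Ecw ← E-extend (E-sym (Linked.head linked))
      with w ∈? rest
    ... | no w∉rest =
      walk fuel (prev ∷ rest)
           (((λ { refl → E-irrefl Ecw }) ∷ w≢prev ∷ ¬Any⇒All¬ rest w∉rest) ∷ uniq)
           ((cur , E-sym Ecw) ∷ active) (E-sym Ecw ∷ linked)
           (subst (N <_) (+-suc (length (cur ∷ prev ∷ rest)) fuel) N<path)
    ... | yes w∈rest with ys , zs , refl ← ∈-∃++ w∈rest =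
      cycle , s≤s (s≤s (length-++-≤ʳ [ w ] {ys})) ,
      AllPairs-++⁻ˡ cycle (subst Unique path≡ uniq) ,
      ++⁻ˡ cycle (subst (All (∃ ∘ E)) path≡ active) ,
      Linked-∷ʳ⁺ (cur ∷ prev ∷ ys) (Linked-++⁻ˡ cycle (subst (Linked E) path≡ linked)) (E-sym Ecw)
      where
      cycle = cur ∷ prev ∷ ys ∷ʳ w
      path≡ : cur ∷ prev ∷ ys ++ [ w ] ++ zs ≡ cycle ++ zs
      path≡ = sym (++-assoc (cur ∷ prev ∷ ys) [ w ] zs)

  edge⇒cycle : ∀ {u v} → E u v → Cycle
  edge⇒cycle {u} {v} Euv =
    walk N [] (((λ { refl → E-irrefl Euv }) ∷ []) ∷ [] ∷ [])
         ((u , E-sym Euv) ∷ (v , Euv) ∷ []) (E-sym Euv ∷ [-]) (m<n+m N z<s)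

-- Prime factorisation

*-^-distrib : ∀ x y e → (x * y) ^ e ≡ x ^ e * y ^ e
*-^-distrib x y zero    = refl
*-^-distrib x y (suc e) = trans (cong (x * y *_) (*-^-distrib x y e)) (*-interchange x y (x ^ e) (y ^ e))

module _ {p : ℕ} (prime : Prime p) where

  private instance
    p≢0 : NonZero p
    p≢0 = prime⇒nonZero prime

  prime∤1 : ¬ p ∣ 1
  prime∤1 p∣1 = ¬prime[1] (subst Prime (∣1⇒≡1 p∣1) prime)

  prime∤* : ∀ {m n} → ¬ p ∣ m → ¬ p ∣ n → ¬ p ∣ m * n
  prime∤* {m} {n} p∤m p∤n p∣mn = [ p∤m , p∤n ]′ (euclidsLemma m n prime p∣mn)

  prime∣prime⇒≡ : ∀ {q} → Prime q → p ∣ q → p ≡ q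
  prime∣prime⇒≡ prime-q p∣q with prime⇒irreducible prime-q p∣q
  ... | inj₁ refl = contradiction prime ¬prime[1]
  ... | inj₂ p≡q  = p≡q

  prime∣prime*prime : ∀ {q r} → Prime q → Prime r → p ∣ q * r → p ≡ q ⊎ p ≡ r
  prime∣prime*prime {q} {r} prime-q prime-r p∣qr =
    Sum.map (prime∣prime⇒≡ prime-q) (prime∣prime⇒≡ prime-r) (euclidsLemma q r prime p∣qr)

  prime∣^⇒∣ : ∀ {x} e → p ∣ x ^ e → p ∣ x
  prime∣^⇒∣     zero    p∣1     = contradiction p∣1 prime∤1
  prime∣^⇒∣ {x} (suc e) p∣x^1+e with euclidsLemma x (x ^ e) prime p∣x^1+e
  ... | inj₁ p∣x   = p∣x
  ... | inj₂ p∣x^e = prime∣^⇒∣ e p∣x^e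

  private
    p∣p^[1+c]*m : ∀ c m → p ∣ p ^ suc c * m
    p∣p^[1+c]*m c m = ∣m⇒∣m*n m (m∣m*n (p ^ c))

  p^c*m≡p^d*n⇒c≡d : ∀ {m n} c d → ¬ p ∣ m → ¬ p ∣ n → p ^ c * m ≡ p ^ d * n → c ≡ d
  p^c*m≡p^d*n⇒c≡d         zero    zero    _   _   _  = refl
  p^c*m≡p^d*n⇒c≡d {m}     zero    (suc d) p∤m _   eq =
    contradiction (subst (p ∣_) (trans (sym eq) (*-identityˡ m)) (p∣p^[1+c]*m d _)) p∤m
  p^c*m≡p^d*n⇒c≡d {n = n} (suc c) zero    _   p∤n eq =
    contradiction (subst (p ∣_) (trans eq (*-identityˡ n)) (p∣p^[1+c]*m c _)) p∤n
  p^c*m≡p^d*n⇒c≡d {m} {n} (suc c) (suc d) p∤m p∤n eq =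
    cong suc (p^c*m≡p^d*n⇒c≡d c d p∤m p∤n (*-cancelˡ-≡ _ _ p (begin
      p * (p ^ c * m)  ≡⟨ *-assoc p (p ^ c) m ⟨
      p ^ suc c * m    ≡⟨ eq ⟩
      p ^ suc d * n    ≡⟨ *-assoc p (p ^ d) n ⟩
      p * (p ^ d * n)  ∎)))
    where open ≡-Reasoning

  p-adic-split : ∀ x → .{{NonZero x}} → ∃₂ λ v y → ¬ p ∣ y × x ≡ p ^ v * y
  p-adic-split x = go x (<-wellFounded x)
    where
    open ≡-Reasoning
    go : ∀ x → .{{NonZero x}} → Acc _<_ x → ∃₂ λ v y → ¬ p ∣ y × x ≡ p ^ v * y
    go x (acc rec) with p ∣? x
    ... | no p∤x = 0 , x , p∤x , sym (*-identityˡ x)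
    ... | yes (divides q refl) =
      let instance _ = m*n≢0⇒m≢0 q
          v , y , p∤y , q≡ = go q (rec (m<m*n q p (nonTrivial⇒n>1 p {{prime⇒nonTrivial prime}})))
      in suc v , y , p∤y , (begin
        q * p            ≡⟨ cong (_* p) q≡ ⟩
        p ^ v * y * p    ≡⟨ *-comm (p ^ v * y) p ⟩
        p * (p ^ v * y)  ≡⟨ *-assoc p (p ^ v) y ⟨
        p ^ suc v * y    ∎)

  p^c*m≡x^e⇒e∣c : ∀ {m c} x e → .{{NonZero e}} → ¬ p ∣ m → p ^ c * m ≡ x ^ e → e ∣ c
  p^c*m≡x^e⇒e∣c {m} {c} zero (suc e) p∤m eq = contradiction (subst (p ∣_) (sym m≡0) (p ∣0)) p∤m
    where
    m≡0 : m ≡ 0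
    m≡0 = m*n≡0⇒m≡0 m (p ^ c) {{m^n≢0 p c}} (trans (*-comm m (p ^ c)) eq)
  p^c*m≡x^e⇒e∣c {m} {c} x@(suc _) e p∤m eq with v , y , p∤y , x≡ ← p-adic-split x =
    divides v (p^c*m≡p^d*n⇒c≡d c (v * e) p∤m (p∤y ∘ prime∣^⇒∣ e) (trans eq x^e≡))
    where
    open ≡-Reasoning
    x^e≡ : x ^ e ≡ p ^ (v * e) * y ^ e
    x^e≡ = begin
      x ^ e                ≡⟨ cong (_^ e) x≡ ⟩
      (p ^ v * y) ^ e      ≡⟨ *-^-distrib (p ^ v) y e ⟩
      (p ^ v) ^ e * y ^ e  ≡⟨ cong (_* y ^ e) (^-*-assoc p v e) ⟩
      p ^ (v * e) * y ^ e  ∎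

  product-split : ∀ as → All (λ a → ¬ p * p ∣ a) as →
                  ∃[ m ] (¬ p ∣ m × product as ≡ p ^ count (p ∣?_) as * m)
  product-split []       []             = 1 , prime∤1 , refl
  product-split (a ∷ as) (p²∤a ∷ p²∤as) with m , p∤m , as≡ ← product-split as p²∤as | p ∣? a
  ... | no p∤a = a * m , prime∤* p∤a p∤m , (begin
    a * product as  ≡⟨ cong (a *_) as≡ ⟩
    a * (pᶜ * m)    ≡⟨ *-exchange a pᶜ m ⟩
    pᶜ * (a * m)    ∎)
    where
    open ≡-Reasoning
    pᶜ = p ^ count (p ∣?_) as
  ... | yes (divides q refl) = q * m , prime∤* p∤q p∤m , (begin
    q * p * product as  ≡⟨ cong (q * p *_) as≡ ⟩
    q * p * (pᶜ * m)    ≡⟨ cong (_* (pᶜ * m)) (*-comm q p) ⟩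
    p * q * (pᶜ * m)    ≡⟨ *-interchange p q pᶜ m ⟩
    p * pᶜ * (q * m)    ∎)
    where
    open ≡-Reasoning
    pᶜ = p ^ count (p ∣?_) as
    p∤q : ¬ p ∣ q
    p∤q (divides r refl) = p²∤a (divides r (*-assoc r p p))

-- The sets Qₙ, Rₙ and S

Qn⇒¬Rn : ∀ {n v} → Qn n v → ¬ Rn n v
Qn⇒¬Rn (_ , v²≤n) (_ , n<v² , _) = <⇒≱ n<v² v²≤n

module _ {n : ℕ} {A : ℕ → Set} (products : IsProductSet n A) where

  prime∣S-cases : ∀ {v a} → Prime v → Sset n A a → v ∣ a →
                  (Rn n v × a ≡ v) ⊎ (Qn n v × ∃[ w ] (Qn n w × Adj A v w × a ≡ v * w))
  prime∣S-cases prime-v (inj₁ Ra) v∣a with prime∣prime⇒≡ prime-v (proj₁ Ra) v∣a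
  ... | refl = inj₁ (Ra , refl)
  prime∣S-cases prime-v (inj₂ Aa) v∣a with products _ Aa
  ... | p , q , Qp , Qq , p≢q , refl with prime∣prime*prime prime-v (proj₁ Qp) (proj₁ Qq) v∣a
  ...   | inj₁ refl = inj₂ (Qp , q , Qq , (p≢q , Aa) , refl)
  ...   | inj₂ refl = inj₂ (Qq , p , Qp , (p≢q ∘ sym , subst A (*-comm p q) Aa) , *-comm p q)

  S-two-prime-divisors : ∀ {a} → Sset n A a → ∃₂ λ p q → ∀ {v} → Prime v → v ∣ a → v ≡ p ⊎ v ≡ q
  S-two-prime-divisors {a} (inj₁ (prime-a , _)) =
    a , a , λ prime-v v∣a → inj₁ (prime∣prime⇒≡ prime-v prime-a v∣a)
  S-two-prime-divisors (inj₂ Aa) with products _ Aa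
  ... | p , q , (prime-p , _) , (prime-q , _) , _ , refl =
    p , q , λ prime-v → prime∣prime*prime prime-v prime-p prime-q

  S-squarefree : ∀ {v a} → Prime v → Sset n A a → ¬ v * v ∣ a
  S-squarefree {v} prime-v Sa v²∣a with prime∣S-cases prime-v Sa (∣-trans (m∣m*n v) v²∣a)
  ... | inj₁ (_ , refl) =
    prime∤1 prime-v (*-cancelˡ-∣ v {{prime⇒nonZero prime-v}} (subst (v * v ∣_) (sym (*-identityʳ v)) v²∣a))
  ... | inj₂ (_ , w , Qw , (v≢w , _) , refl) =
    v≢w (prime∣prime⇒≡ prime-v (proj₁ Qw) (*-cancelˡ-∣ v {{prime⇒nonZero prime-v}} v²∣a))

  module Solution {k : ℕ} {as : List ℕ} {x : ℕ} (length-as : length as ≡ 3 * k)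
                  (as⊆S : All (Sset n A) as) (cube : product as ≡ x ^ 3) where

    open Multiplicity _≟_ public

    deg : ℕ → ℕ
    deg v = count (v ∣?_) as

    3∣deg : ∀ {v} → Prime v → 3 ∣ deg v
    3∣deg prime-v with m , v∤m , as≡ ← product-split prime-v as (All.map (S-squarefree prime-v) as⊆S) =
      p^c*m≡x^e⇒e∣c prime-v x 3 v∤m (trans (sym as≡) cube)

    few-dividing-primes : ∀ {C} → Unique C → All (λ v → Prime v × 0 < deg v) C → length C ≤ 2 * k
    few-dividing-primes {C} uniq dividing = *-cancelˡ-≤ 3 (begin
      3 * length C   ≤⟨ double-counting _∣?_ C as (All.map deg≥3 dividing) (All.map divisors≤2 as⊆S) ⟩
      2 * length as  ≡⟨ cong (2 *_) length-as ⟩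
      2 * (3 * k)    ≡⟨ *-exchange 2 3 k ⟩
      3 * (2 * k)    ∎)
      where
      open ≤-Reasoning
      deg≥3 : ∀ {v} → Prime v × 0 < deg v → 3 ≤ deg v
      deg≥3 (prime-v , deg>0) = ∣⇒≤ {{>-nonZero deg>0}} (3∣deg prime-v)
      divisors≤2 : ∀ {a} → Sset n A a → count (_∣? a) C ≤ 2
      divisors≤2 {a} Sa with p , q , divisors ← S-two-prime-divisors Sa =
        unique-pair-length≤2 (Unique.filter⁺ (_∣? a) uniq)
          (All.zipWith (λ (prime-v , v∣a) → divisors prime-v v∣a)
                       (All.filter⁺ (_∣? a) (All.map proj₁ dividing) , all-filter (_∣? a) C))

    Unbalanced : ℕ → Set
    Unbalanced a = a ∈ as × ¬ 3 ∣ multiplicity a as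

    other-multiples : ℕ → ℕ → List ℕ
    other-multiples v e = filter (∁? (e ≟_)) (filter (v ∣?_) as)

    3∤other-multiples : ∀ {v e} → Prime v → v ∣ e → ¬ 3 ∣ multiplicity e as →
                        ¬ 3 ∣ length (other-multiples v e)
    3∤other-multiples {v} {e} prime-v v∣e 3∤e 3∣others =
      3∤e (∣m+n∣m⇒∣n (subst (3 ∣_) deg≡ (3∣deg prime-v)) 3∣others)
      where
      deg≡ : deg v ≡ length (other-multiples v e) + multiplicity e as
      deg≡ = trans (count-split (v ∣?_) v∣e as) (+-comm (multiplicity e as) (length (other-multiples v e)))

    another-unbalanced-multiple : ∀ {v e} → Prime v → v ∣ e → Unbalanced e →
                                  ∃[ a ] (Unbalanced a × v ∣ a × a ≢ e)
    another-unbalanced-multiple {v} {e} prime-v v∣e (_ , 3∤e)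
      with a , a∈others , 3∤a ← find (¬All⇒Any¬ (λ a → 3 ∣? multiplicity a (other-multiples v e)) _
                                        (3∤other-multiples prime-v v∣e 3∤e ∘
                                         divisible-multiplicities⇒∣length 3 (other-multiples v e)))
      with a∈multiples , e≢a ← ∈-filter⁻ (∁? (e ≟_)) a∈others
      with a∈as , v∣a ← ∈-filter⁻ (v ∣?_) a∈multiples =
      a , (a∈as , 3∤a ∘ subst (3 ∣_) (sym multiplicity≡)) , v∣a , e≢a ∘ sym
      where
      multiplicity≡ : multiplicity a (other-multiples v e) ≡ multiplicity a as
      multiplicity≡ = trans (multiplicity-filter (∁? (e ≟_)) e≢a (filter (v ∣?_) as))
                            (multiplicity-filter (v ∣?_) v∣a as)

    unbalanced⇒¬Rn : ∀ {r} → Unbalanced r → ¬ Rn n r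
    unbalanced⇒¬Rn unb Rr
      with a , (a∈as , _) , r∣a , a≢r ← another-unbalanced-multiple (proj₁ Rr) ∣-refl unb
      with prime∣S-cases (proj₁ Rr) (All.lookup as⊆S a∈as) r∣a
    ... | inj₁ (_ , a≡r) = a≢r a≡r
    ... | inj₂ (Qr , _)  = Qn⇒¬Rn Qr Rr

    UnbalancedEdge : ℕ → ℕ → Set
    UnbalancedEdge u v = Qn n u × Qn n v × Adj A u v × Unbalanced (u * v)

    UnbalancedEdge-sym : Symmetric UnbalancedEdge
    UnbalancedEdge-sym {u} {v} (Qu , Qv , (u≢v , Auv) , unb) =
      Qv , Qu , (u≢v ∘ sym , subst A (*-comm u v) Auv) , subst Unbalanced (*-comm u v) unb

    UnbalancedEdge-irrefl : ∀ {v} → ¬ UnbalancedEdge v v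
    UnbalancedEdge-irrefl (_ , _ , (v≢v , _) , _) = v≢v refl

    UnbalancedEdge-extend : ∀ {u v} → UnbalancedEdge u v → ∃[ w ] (w ≢ u × UnbalancedEdge v w)
    UnbalancedEdge-extend {u} {v} (_ , Qv , _ , unb)
      with a , unb-a , v∣a , a≢uv ← another-unbalanced-multiple (proj₁ Qv) (n∣m*n u) unb
      with prime∣S-cases (proj₁ Qv) (All.lookup as⊆S (proj₁ unb-a)) v∣a
    ... | inj₁ (Rv , _) = contradiction Rv (Qn⇒¬Rn Qv)
    ... | inj₂ (_ , w , Qw , adj , refl) =
      w , (λ { refl → a≢uv (*-comm v u) }) , Qv , Qw , adj , unb-a

    few-unbalanced-vertices : ∀ {vs} → Unique vs → All (∃ ∘ UnbalancedEdge) vs → length vs ≤ 2 * k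
    few-unbalanced-vertices uniq unbalanced = few-dividing-primes uniq (All.map dividing unbalanced)
      where
      dividing : ∀ {v} → ∃ (UnbalancedEdge v) → Prime v × 0 < deg v
      dividing {v} (w , (prime-v , _) , _ , _ , (vw∈as , _)) =
        prime-v , filter-some (v ∣?_) (lose vw∈as (m∣m*n w))

    module _ (acyclic : ∀ ℓ → 3 ≤ ℓ → ℓ ≤ 2 * k → ¬ HasCycle n A ℓ) where

      no-unbalanced-edge : ∀ {u v} → ¬ UnbalancedEdge u v
      no-unbalanced-edge uv
        with vs , 3≤ℓ , uniq , unbalanced , linked
               ← Cycles.edge⇒cycle _≟_ UnbalancedEdge-sym UnbalancedEdge-irrefl UnbalancedEdge-extend
                                   few-unbalanced-vertices uv =
        acyclic (length vs) 3≤ℓ (few-unbalanced-vertices uniq unbalanced)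
          (vs , refl , uniq , All.map (proj₁ ∘ proj₂) unbalanced ,
           Linked.map (proj₁ ∘ proj₂ ∘ proj₂) linked)

      no-unbalanced-value : ∀ {a} → ¬ Unbalanced a
      no-unbalanced-value unb@(a∈as , _) with All.lookup as⊆S a∈as
      ... | inj₁ Ra = unbalanced⇒¬Rn unb Ra
      ... | inj₂ Aa with p , q , Qp , Qq , p≢q , refl ← products _ Aa =
        no-unbalanced-edge (Qp , Qq , (p≢q , Aa) , unb)

lemma4 : (k n : ℕ) → 2 ≤ k → 1 ≤ n → (A : ℕ → Set) → IsProductSet n A →
         ((ℓ : ℕ) → 3 ≤ ℓ → ℓ ≤ 2 * k → ¬ HasCycle n A ℓ) →
         (as : List ℕ) (x : ℕ) → length as ≡ 3 * k → All (Sset n A) as →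
         product as ≡ x ^ 3 → Trivial as
lemma4 k n _ _ A products acyclic as x length-as as⊆S cube = ↭-concatMap-replicate 3 as balanced
  where
  open Solution products {k = k} {x = x} length-as as⊆S cube
  balanced : All (λ a → 3 ∣ multiplicity a as) as
  balanced = All.tabulate λ a∈as →
    decidable-stable (3 ∣? _) (λ 3∤a → no-unbalanced-value acyclic (a∈as , 3∤a))
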